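{- For Muchnik degrees $\mathbf{A}$ and $\mathbf{B}$ with $\mathbf{A}<_w\mathbf{B}$, the interval $(\mathbf{A},\mathbf{B})=\{\mathbf{X}:\mathbf{A}<_w\mathbf{X}<_w\mathbf{B}\}$ is empty if and only if there is a degree of solvability $\mathbf{S}$ such that $\mathbf{A}\equiv_w\mathbf{B}\times\mathbf{S}$, $\mathbf{B}\not\le_w\mathbf{S}$, and $\mathbf{B}\le_w\mathbf{S}'$.
   Context: Mass problems are subsets of Baire space $\omega^\omega$. For mass problems $\mathcal{A},\mathcal{B}$, $\mathcal{A}\le_w\mathcal{B}$ iff for every $f\in\mathcal{B}$ there is $g\in\mathcal{A}$ with $g\le_T f$; $\equiv_w$ is the induced equivalence and Muchnik degrees are its classes, ordered by $\le_w$. The meet $\mathbf{B}\times\mathbf{S}$ is the degree of $\{0^\frown f: f\in\mathcal{B}\}\cup\{1^\frown g:g\in\mathcal{S}\}$ for representatives $\mathcal{B},\mathcal{S}$. A degree of solvability is a Muchnik degree containing a singleton $\{f\}$; for $\mathbf{S}=\deg_w(\{f\})$, $\mathbf{S}'$ denotes the Muchnik degree of $\{g\in\omega^\omega: f<_T g\}$. -}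

module Defs where

open import Data.Nat using (ℕ; zero; suc; _<_)
open import Data.Fin using (Fin)
open import Data.Vec using (Vec; []; _∷_; lookup)
open import Data.Product using (Σ; ∃; _×_; _,_)
open import Data.Sum using (_⊎_)
open import Relation.Nullary using (¬_)
open import Relation.Binary.PropositionalEquality using (_≡_; _≗_)

-- Oracle computation: Kleene's μ-recursive functions relative to an
-- oracle f : ℕ → ℕ.  Code k = codes of k-ary partial functionals.

data Code : ℕ → Set where
  zeroᶜ : ∀ {k} → Code k
  succᶜ : Code 1
  projᶜ : ∀ {k} → Fin k → Code k
  orcᶜ  : Code 1
  compᶜ : ∀ {k m} → Code m → Vec (Code k) m → Code k
  recᶜ  : ∀ {k} → Code k → Code (suc (suc k)) → Code (suc k)
  muᶜ   : ∀ {k} → Code (suc k) → Code k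

-- Big-step semantics: Eval f c xs y  means  φ_c^f(xs)↓ = y.
mutual
  data Eval (f : ℕ → ℕ) : ∀ {k} → Code k → Vec ℕ k → ℕ → Set where
    ev-zero : ∀ {k} {xs : Vec ℕ k} → Eval f zeroᶜ xs 0
    ev-succ : ∀ {x} → Eval f succᶜ (x ∷ []) (suc x)
    ev-proj : ∀ {k} {i : Fin k} {xs} → Eval f (projᶜ i) xs (lookup xs i)
    ev-orc  : ∀ {x} → Eval f orcᶜ (x ∷ []) (f x)
    ev-comp : ∀ {k m} {g : Code m} {hs : Vec (Code k) m} {xs ys y} →
              EvalAll f hs xs ys → Eval f g ys y → Eval f (compᶜ g hs) xs y
    ev-rec0 : ∀ {k} {g : Code k} {h : Code (suc (suc k))} {xs y} →
              Eval f g xs y → Eval f (recᶜ g h) (0 ∷ xs) y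
    ev-recS : ∀ {k} {g : Code k} {h : Code (suc (suc k))} {n xs z y} →
              Eval f (recᶜ g h) (n ∷ xs) z → Eval f h (n ∷ z ∷ xs) y →
              Eval f (recᶜ g h) (suc n ∷ xs) y
    ev-mu   : ∀ {k} {g : Code (suc k)} {xs n} →
              Eval f g (n ∷ xs) 0 →
              (∀ m → m < n → ∃ λ v → Eval f g (m ∷ xs) (suc v)) →
              Eval f (muᶜ g) xs n

  data EvalAll (f : ℕ → ℕ) {k : ℕ} : ∀ {m} → Vec (Code k) m → Vec ℕ k → Vec ℕ m → Set where
    []  : ∀ {xs} → EvalAll f [] xs []
    _∷_ : ∀ {m} {h : Code k} {hs : Vec (Code k) m} {xs y ys} →
          Eval f h xs y → EvalAll f hs xs ys → EvalAll f (h ∷ hs) xs (y ∷ ys)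

_≤T_ : (ℕ → ℕ) → (ℕ → ℕ) → Set
g ≤T f = ∃ λ (c : Code 1) → ∀ n → Eval f c (n ∷ []) (g n)

_<T_ : (ℕ → ℕ) → (ℕ → ℕ) → Set
g <T f = g ≤T f × ¬ (f ≤T g)

-- Mass problems and Muchnik reducibility.  Muchnik degrees are handled
-- through their representatives (mass problems).

MassProblem : Set₁
MassProblem = (ℕ → ℕ) → Set

_≤w_ : MassProblem → MassProblem → Set
A ≤w B = ∀ f → B f → ∃ λ g → A g × g ≤T f

_≡w_ : MassProblem → MassProblem → Set
A ≡w B = A ≤w B × B ≤w A

_<w_ : MassProblem → MassProblem → Set
A <w B = A ≤w B × ¬ (B ≤w A)

tailω : (ℕ → ℕ) → (ℕ → ℕ)
tailω h n = h (suc n)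

-- Meet  B × S = {0⌢f : f ∈ B} ∪ {1⌢g : g ∈ S}
_⊗_ : MassProblem → MassProblem → MassProblem
(B ⊗ S) h = (h 0 ≡ 0 × B (tailω h)) ⊎ (h 0 ≡ 1 × S (tailω h))

⟦_⟧ : (ℕ → ℕ) → MassProblem
⟦ f ⟧ g = g ≗ f

-- Jump of the degree of solvability of {f}: { g : f <T g }
Jump : (ℕ → ℕ) → MassProblem
Jump f g = f <T g

EmptyInterval : MassProblem → MassProblem → Set₁
EmptyInterval A B = ¬ (Σ MassProblem λ X → A <w X × X <w B)

IsSolvabilityOf : MassProblem → (ℕ → ℕ) → Set
IsSolvabilityOf S f = S ≡w ⟦ f ⟧

{-# OPTIONS --safe #-}
-- Everything rests on two facts about meets with singletons. If A ≤w B and g computes a member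
-- of A, then A ≤w B ⊗ {g} ≤w B; and {h} lies above B ⊗ C only if it lies above B or above C.
-- (⇒) Pick f ∈ A computing no member of B (possible as B ≰w A). Emptiness of (A, B) forces
-- B ⊗ {f} ≡w A, and for f <T g it forces B ⊗ {g} ≡w B, since B ⊗ {g} ≤w A ≤w {f} would make
-- f compute a member of B or g. (⇐) An X in the interval has a member g computing no member of
-- B. As g computes a member of A ≡w B ⊗ {f}, f ≤T g; then g ≤T f yields X ≤w B ⊗ {f} ≡w A,
-- while f <T g yields B ≤w {g}.
module Submission where

open import Defs
open import Data.Nat using (ℕ; zero; suc)
import Level
open import Level using (0ℓ; _⊔_; Lift; lift; lower)
open import Axiom.ExcludedMiddle using (ExcludedMiddle)
open import Data.Product using (Σ; _×_; _,_; ∃; proj₁; proj₂)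
open import Data.Sum using (_⊎_; inj₁; inj₂)
open import Data.Fin using () renaming (zero to fzero)
open import Data.Vec using (Vec; []; _∷_)
open import Data.Empty using (⊥-elim)
open import Function.Bundles using (_⇔_; mk⇔)
open import Relation.Nullary using (¬_; yes; no)
open import Relation.Nullary.Decidable using (map′; decidable-stable)
open import Relation.Binary.PropositionalEquality using (refl; sym; subst; _≗_)

mutual
  substOracle : ∀ {k} → Code 1 → Code k → Code k
  substOracle c zeroᶜ        = zeroᶜ
  substOracle c succᶜ        = succᶜ
  substOracle c (projᶜ i)    = projᶜ i
  substOracle c orcᶜ         = c
  substOracle c (compᶜ g hs) = compᶜ (substOracle c g) (substOracles c hs)
  substOracle c (recᶜ g h)   = recᶜ (substOracle c g) (substOracle c h)
  substOracle c (muᶜ g)      = muᶜ (substOracle c g)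

  substOracles : ∀ {k m} → Code 1 → Vec (Code k) m → Vec (Code k) m
  substOracles c []       = []
  substOracles c (h ∷ hs) = substOracle c h ∷ substOracles c hs

module _ {f g : ℕ → ℕ} {c : Code 1} (c-computes-g : ∀ n → Eval f c (n ∷ []) (g n)) where
  mutual
    eval-substOracle : ∀ {k} {d : Code k} {xs y} → Eval g d xs y → Eval f (substOracle c d) xs y
    eval-substOracle ev-zero         = ev-zero
    eval-substOracle ev-succ         = ev-succ
    eval-substOracle ev-proj         = ev-proj
    eval-substOracle (ev-orc {x})    = c-computes-g x
    eval-substOracle (ev-comp es e)  = ev-comp (evalAll-substOracles es) (eval-substOracle e)
    eval-substOracle (ev-rec0 e)     = ev-rec0 (eval-substOracle e)
    eval-substOracle (ev-recS e e′)  = ev-recS (eval-substOracle e) (eval-substOracle e′)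
    eval-substOracle (ev-mu e below) =
      ev-mu (eval-substOracle e) (λ m m<n → proj₁ (below m m<n) , eval-substOracle (proj₂ (below m m<n)))

    evalAll-substOracles : ∀ {k m} {hs : Vec (Code k) m} {xs ys} →
                           EvalAll g hs xs ys → EvalAll f (substOracles c hs) xs ys
    evalAll-substOracles []       = []
    evalAll-substOracles (e ∷ es) = eval-substOracle e ∷ evalAll-substOracles es

≤T-trans : ∀ {h g f} → h ≤T g → g ≤T f → h ≤T f
≤T-trans (d , d-computes-h) (c , c-computes-g) =
  substOracle c d , λ n → eval-substOracle c-computes-g (d-computes-h n)

≤T-reflexive : ∀ {g f} → g ≗ f → g ≤T f
≤T-reflexive {g} {f} g≗f = orcᶜ , λ n → subst (Eval f orcᶜ (n ∷ [])) (sym (g≗f n)) ev-orc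

≤T-refl : ∀ {f} → f ≤T f
≤T-refl = ≤T-reflexive (λ _ → refl)

tailω≤T : ∀ {h} → tailω h ≤T h
tailω≤T = compᶜ orcᶜ (compᶜ succᶜ (projᶜ fzero ∷ []) ∷ []) ,
          λ n → ev-comp (ev-comp (ev-proj ∷ []) ev-succ ∷ []) ev-orc

cons : ℕ → (ℕ → ℕ) → ℕ → ℕ
cons k g zero    = k
cons k g (suc n) = g n

numeral : ℕ → Code 0
numeral zero    = zeroᶜ
numeral (suc k) = compᶜ succᶜ (numeral k ∷ [])

eval-numeral : ∀ {f} k → Eval f (numeral k) [] k
eval-numeral zero    = ev-zero
eval-numeral (suc k) = ev-comp (eval-numeral k ∷ []) ev-succ

cons≤T : ∀ {g} k → cons k g ≤T g
cons≤T k = recᶜ (numeral k) (compᶜ orcᶜ (projᶜ fzero ∷ [])) , eval-cons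
  where
  eval-cons : ∀ {g} n → Eval g (recᶜ (numeral k) (compᶜ orcᶜ (projᶜ fzero ∷ []))) (n ∷ []) (cons k g n)
  eval-cons zero    = ev-rec0 (eval-numeral k)
  eval-cons (suc n) = ev-recS (eval-cons n) (ev-comp (ev-proj ∷ []) ev-orc)

≤w-refl : ∀ {A} → A ≤w A
≤w-refl f Af = f , Af , ≤T-refl

≡w-refl : ∀ {A} → A ≡w A
≡w-refl = ≤w-refl , ≤w-refl

≤w-trans : ∀ {X Y Z} → X ≤w Y → Y ≤w Z → X ≤w Z
≤w-trans X≤Y Y≤Z f Zf with Y≤Z f Zf
... | g , Yg , g≤f with X≤Y g Yg
... | h , Xh , h≤g = h , Xh , ≤T-trans h≤g g≤f

⊗-lowerˡ : ∀ {B C} → (B ⊗ C) ≤w B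
⊗-lowerˡ f Bf = cons 0 f , inj₁ (refl , Bf) , cons≤T 0

⊗-lowerʳ : ∀ {B C} → (B ⊗ C) ≤w C
⊗-lowerʳ f Cf = cons 1 f , inj₂ (refl , Cf) , cons≤T 1

⊗-greatest : ∀ {A B C} → A ≤w B → A ≤w C → A ≤w (B ⊗ C)
⊗-greatest {A} {B} {C} A≤B A≤C h h∈B⊗C with from-tail h∈B⊗C
  where
  from-tail : (B ⊗ C) h → ∃ λ a → A a × a ≤T tailω h
  from-tail (inj₁ (_ , Bt)) = A≤B (tailω h) Bt
  from-tail (inj₂ (_ , Ct)) = A≤C (tailω h) Ct
... | a , Aa , a≤t = a , Aa , ≤T-trans a≤t tailω≤T

≤T-member⇒≤w⟦⟧ : ∀ {A a f} → A a → a ≤T f → A ≤w ⟦ f ⟧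
≤T-member⇒≤w⟦⟧ Aa a≤f h h≗f = _ , Aa , ≤T-trans a≤f (≤T-reflexive (λ n → sym (h≗f n)))

member⇒≤w⟦⟧ : ∀ {A f} → A f → A ≤w ⟦ f ⟧
member⇒≤w⟦⟧ Af = ≤T-member⇒≤w⟦⟧ Af ≤T-refl

≤w⟦⟧⇒≤T-member : ∀ {A f} → A ≤w ⟦ f ⟧ → ∃ λ a → A a × a ≤T f
≤w⟦⟧⇒≤T-member A≤f = A≤f _ (λ _ → refl)

⟦⟧≤w⟦⟧⇒≤T : ∀ {g f} → ⟦ g ⟧ ≤w ⟦ f ⟧ → g ≤T f
⟦⟧≤w⟦⟧⇒≤T ⟦g⟧≤f with ≤w⟦⟧⇒≤T-member ⟦g⟧≤f
... | h , h≗g , h≤f = ≤T-trans (≤T-reflexive (λ n → sym (h≗g n))) h≤f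

⊗≤w⟦⟧⇒⊎ : ∀ {B C f} → (B ⊗ C) ≤w ⟦ f ⟧ → B ≤w ⟦ f ⟧ ⊎ C ≤w ⟦ f ⟧
⊗≤w⟦⟧⇒⊎ B⊗C≤f with ≤w⟦⟧⇒≤T-member B⊗C≤f
... | h , inj₁ (_ , Bt) , h≤f = inj₁ (≤T-member⇒≤w⟦⟧ Bt (≤T-trans tailω≤T h≤f))
... | h , inj₂ (_ , Ct) , h≤f = inj₂ (≤T-member⇒≤w⟦⟧ Ct (≤T-trans tailω≤T h≤f))

CoverWitness : MassProblem → MassProblem → Set₁
CoverWitness A B = Σ MassProblem λ S → Σ (ℕ → ℕ) λ f → IsSolvabilityOf S f ×
  A ≡w (B ⊗ S) × ¬ (B ≤w S) × B ≤w Jump f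

lowerExcludedMiddle : ∀ {a} b → ExcludedMiddle (a ⊔ b) → ExcludedMiddle a
lowerExcludedMiddle b em = map′ lower lift (em {Lift b _})

module _ (em : ExcludedMiddle 0ℓ) where

  ≰w⇒∃member : ∀ {A B} → ¬ (B ≤w A) → ∃ λ g → A g × ¬ (B ≤w ⟦ g ⟧)
  ≰w⇒∃member B≰A = decidable-stable em λ no-witness →
    B≰A λ g Ag → ≤w⟦⟧⇒≤T-member (decidable-stable em λ B≰g → no-witness (g , Ag , B≰g))

  emptyInterval-dichotomy : ∀ {A B X} → EmptyInterval A B → A ≤w X → X ≤w B → X ≤w A ⊎ B ≤w X
  emptyInterval-dichotomy {A} {B} {X} empty A≤X X≤B with em {X ≤w A} | em {B ≤w X}
  ... | yes X≤A | _        = inj₁ X≤A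
  ... | no _    | yes B≤X  = inj₂ B≤X
  ... | no X≰A  | no B≰X   = ⊥-elim (empty (X , (A≤X , X≰A) , (X≤B , B≰X)))

  emptyInterval⇒coverWitness : ∀ {A B} → A <w B → EmptyInterval A B → CoverWitness A B
  emptyInterval⇒coverWitness {A} {B} (A≤B , B≰A) empty with ≰w⇒∃member B≰A
  ... | f , Af , B≰f = ⟦ f ⟧ , f , ≡w-refl , (A≤B⊗ ≤T-refl , B⊗f≤A) , B≰f , B≤Jump
    where
    A≤B⊗ : ∀ {g} → f ≤T g → A ≤w (B ⊗ ⟦ g ⟧)
    A≤B⊗ f≤g = ⊗-greatest A≤B (≤T-member⇒≤w⟦⟧ Af f≤g)

    B⊗≤A⊎B≤ : ∀ {g} → f ≤T g → (B ⊗ ⟦ g ⟧) ≤w A ⊎ B ≤w ⟦ g ⟧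
    B⊗≤A⊎B≤ f≤g with emptyInterval-dichotomy empty (A≤B⊗ f≤g) (⊗-lowerˡ {C = ⟦ _ ⟧})
    ... | inj₁ B⊗g≤A = inj₁ B⊗g≤A
    ... | inj₂ B≤B⊗g = inj₂ (≤w-trans B≤B⊗g (⊗-lowerʳ {B}))

    B⊗f≤A : (B ⊗ ⟦ f ⟧) ≤w A
    B⊗f≤A with B⊗≤A⊎B≤ ≤T-refl
    ... | inj₁ B⊗f≤A = B⊗f≤A
    ... | inj₂ B≤f   = ⊥-elim (B≰f B≤f)

    B≤Jump : B ≤w Jump f
    B≤Jump g (f≤g , g≰f) with B⊗≤A⊎B≤ f≤g
    ... | inj₂ B≤g = ≤w⟦⟧⇒≤T-member B≤g
    ... | inj₁ B⊗g≤A with ⊗≤w⟦⟧⇒⊎ (≤w-trans B⊗g≤A (member⇒≤w⟦⟧ Af))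
    ...   | inj₁ B≤f = ⊥-elim (B≰f B≤f)
    ...   | inj₂ g≤f = ⊥-elim (g≰f (⟦⟧≤w⟦⟧⇒≤T g≤f))

  coverWitness⇒emptyInterval : ∀ {A B} → CoverWitness A B → EmptyInterval A B
  coverWitness⇒emptyInterval (S , f , (_ , f≤S) , (_ , B⊗S≤A) , _ , B≤Jump)
                             (X , (A≤X , X≰A) , (X≤B , B≰X))
    with ≰w⇒∃member B≰X
  ... | g , Xg , B≰g with ⊗≤w⟦⟧⇒⊎ (≤w-trans B⊗S≤A (≤w-trans A≤X (member⇒≤w⟦⟧ Xg)))
  ...   | inj₁ B≤g = B≰g B≤g
  ...   | inj₂ S≤g with em {g ≤T f}
  ...     | yes g≤f = X≰A (≤w-trans (⊗-greatest X≤B X≤S) B⊗S≤A)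
    where
    X≤S : X ≤w S
    X≤S = ≤w-trans (≤T-member⇒≤w⟦⟧ Xg g≤f) f≤S
  ...     | no g≰f = B≰g (≤w-trans B≤Jump (member⇒≤w⟦⟧ f<g))
    where
    f<g : f <T g
    f<g = ⟦⟧≤w⟦⟧⇒≤T (≤w-trans f≤S S≤g) , g≰f

theorem1p3 : ExcludedMiddle (Level.suc 0ℓ) → (A B : MassProblem) → A <w B →
  EmptyInterval A B ⇔
    Σ MassProblem (λ S → Σ (ℕ → ℕ) (λ f → IsSolvabilityOf S f ×
      A ≡w (B ⊗ S) × ¬ (B ≤w S) × B ≤w Jump f))
theorem1p3 em A B A<B = mk⇔ (emptyInterval⇒coverWitness em₀ A<B) (coverWitness⇒emptyInterval em₀)
  where em₀ = lowerExcludedMiddle (Level.suc 0ℓ) em
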